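{- Let $K$ be a number field with ring of integers $\mathscr O$ and let $p$ be a prime. Then $\mathrm{Trace}_{K/\mathbb Q}(x)\in p\mathbb Z$ for all $x\in\mathscr O$ if and only if $\mathrm{Trace}_{K/\mathbb Q}(x^p)\in p\mathbb Z$ for all $x\in\mathscr O$. -}

module Defs where

open import Data.Nat as ℕ using (ℕ; zero; suc)
open import Data.Integer as ℤ using (ℤ)
open import Data.Rational as ℚ using (ℚ; 0ℚ; 1ℚ)
open import Data.Fin as Fin using (Fin; zero; suc; toℕ)
open import Data.Product using (Σ; ∃; _,_)
open import Relation.Binary.PropositionalEquality using (_≡_)
open import Relation.Nullary using (¬_; yes; no)

ι : ℤ → ℚ
ι z = z ℚ./ 1

Σℚ : ∀ {n} → (Fin n → ℚ) → ℚ
Σℚ {zero}  f = 0ℚ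
Σℚ {suc n} f = f zero ℚ.+ Σℚ (λ i → f (suc i))

-- Elements of a degree-n ℚ-algebra with a chosen basis e₀ … e_{n-1}:
-- coordinate vectors.
Vecℚ : ℕ → Set
Vecℚ n = Fin n → ℚ

_≈_ : ∀ {n} → Vecℚ n → Vecℚ n → Set
x ≈ y = ∀ i → x i ≡ y i

zeroV : ∀ {n} → Vecℚ n
zeroV _ = 0ℚ

_+V_ : ∀ {n} → Vecℚ n → Vecℚ n → Vecℚ n
(x +V y) i = x i ℚ.+ y i

_·V_ : ∀ {n} → ℚ → Vecℚ n → Vecℚ n
(a ·V x) i = a ℚ.* x i

ιV : ∀ {n} → (Fin n → ℤ) → Vecℚ n
ιV z i = ι (z i)

-- Multiplication given by integral structure constants:
-- e_j · e_k = Σ_l c j k l · e_l.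
module Alg {n : ℕ} (c : Fin n → Fin n → Fin n → ℤ) (one : Fin n → ℤ) where

  mul : Vecℚ n → Vecℚ n → Vecℚ n
  mul x y l = Σℚ (λ j → Σℚ (λ k → x j ℚ.* (y k ℚ.* ι (c j k l))))

  𝟙 : Vecℚ n
  𝟙 = ιV one

  pow : Vecℚ n → ℕ → Vecℚ n
  pow x zero    = 𝟙
  pow x (suc m) = mul x (pow x m)

  IsIntegral : Vecℚ n → Set
  IsIntegral x = Σ ℕ λ d → Σ (Fin d → ℤ) λ a →
    (pow x d +V (λ l → Σℚ (λ i → ι (a i) ℚ.* pow x (toℕ i) l))) ≈ zeroV

  basis : Fin n → Vecℚ n
  basis i j with i Fin.≟ j
  ... | yes _ = 1ℚ
  ... | no  _ = 0ℚ

  -- Tr_{K/ℚ}(x): trace of the ℚ-linear map y ↦ x·y in the basis e_i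
  Tr : Vecℚ n → ℚ
  Tr x = Σℚ (λ i → mul x (basis i) i)

-- A number field K of degree n over ℚ, presented by an integral basis
-- e₀ … e_{n-1}: K = ℚ e₀ ⊕ … ⊕ ℚ e_{n-1} with integral structure
-- constants, and its ring of integers 𝒪 is exactly ℤ e₀ ⊕ … ⊕ ℤ e_{n-1}.
-- (Every number field has an integral basis, so every number field with
-- its ring of integers arises this way.)
record NumberField (n : ℕ) : Set where
  field
    c   : Fin n → Fin n → Fin n → ℤ
    one : Fin n → ℤ
  open Alg c one public
  field
    mul-comm  : ∀ x y → mul x y ≈ mul y x
    mul-assoc : ∀ x y z → mul (mul x y) z ≈ mul x (mul y z)
    mul-identityˡ : ∀ x → mul 𝟙 x ≈ x
    one≢zero  : ¬ (𝟙 ≈ zeroV)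
    inverse   : ∀ x → ¬ (x ≈ zeroV) → ∃ λ y → mul x y ≈ 𝟙
    integral-closed : ∀ x → IsIntegral x → ∃ λ (z : Fin n → ℤ) → x ≈ ιV z

-- For x ∈ 𝒪 with coordinates in the integral basis, Tr(x^m) is the trace of the m-th power of the
-- integer matrix A of multiplication by x, so it suffices that tr(A^p) ≡ tr(A) mod p for every
-- integer matrix A.  In any semiring with an additive ℤ-valued trace satisfying tr(ab) = tr(ba),
-- tr((x+y)^p) ≡ tr(x^p) + tr(y^p) mod p: expanding (x+y)^p as a sum over words in x and y, the
-- trace of a word is invariant under cyclic rotation, and the words containing y exactly k times,
-- 0 < k < p, contribute a multiple of p.  For ℤ this is Fermat's little theorem; for matrices,
-- writing A as the sum of its rows, whose p-th powers have traces A_ii^p, gives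
-- tr(A^p) ≡ Σ A_ii^p ≡ tr(A).
module Submission where

open import Defs
open import Data.Nat.Primality using (Prime)
open import Data.Integer using (ℤ; +_; _*_)
open import Data.Fin using (Fin)
open import Data.Product using (∃; _×_)
open import Relation.Binary.PropositionalEquality using (_≡_)

open import Level using (0ℓ; _⊔_)
open import Function using (_∘_)
open import Data.Bool using (Bool; true; false)
open import Data.List using (List; []; _∷_; _++_; _∷ʳ_; length; replicate)
import Data.List.Properties as List
open import Data.Nat as ℕ using (ℕ; zero; suc)
import Data.Nat.Properties as ℕ
import Data.Nat.Divisibility as ℕ
open import Data.Nat.Primality using (euclidsLemma)
open import Data.Fin as Fin using (zero; suc; toℕ)
import Data.Fin.Properties as Fin
open import Data.Integer as ℤ using (0ℤ; 1ℤ; _+_; _-_)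
import Data.Integer.Properties as ℤ
open import Data.Integer.Divisibility.Signed as ℤ∣ using (_∣_; divides)
open import Data.Integer.Tactic.RingSolver using (solve-∀)
open import Data.Rational as ℚ using (ℚ)
import Data.Rational.Properties as ℚ
open import Data.Rational.Unnormalised as ℚᵘ using (mkℚᵘ; *≡*)
import Data.Rational.Unnormalised.Properties as ℚᵘ
open import Data.Sum using (inj₁; inj₂)
open import Data.Product using (_,_)
open import Data.Empty using (⊥-elim)
open import Relation.Binary.PropositionalEquality
  using (_≢_; refl; sym; trans; cong; cong₂; subst; module ≡-Reasoning)
open import Relation.Nullary using (yes; no)
open import Relation.Binary using (IsEquivalence; Setoid)
open import Algebra.Bundles using (Semiring)
import Algebra.Properties.Semiring.Sum
import Algebra.Construct.Pointwise as Pointwise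
import Algebra.Properties.AbelianGroup ℤ.+-0-abelianGroup as ℤ+
import Relation.Binary.Reasoning.Setoid as SetoidReasoning
open import Algebra.Properties.Semiring.Sum ℤ.+-*-semiring
  using (sum; sum-cong-≗; ∑-distrib-+; ∑-comm; *-distribˡ-sum; *-distribʳ-sum; sum-replicate-zero; sum-init-last)

infix 4 _≡_mod_

-- A record rather than a synonym for + p ∣ a - b, so that a and b can be inferred.

record _≡_mod_ (a b : ℤ) (p : ℕ) : Set where
  constructor divides-difference
  field
    p∣a-b : + p ∣ a - b

module _ {p : ℕ} where

  ≡⇒≡-mod : ∀ {a b} → a ≡ b → a ≡ b mod p
  ≡⇒≡-mod {a} refl = divides-difference (divides 0ℤ (ℤ.+-inverseʳ a))

  ≡-mod-sym : ∀ {a b} → a ≡ b mod p → b ≡ a mod p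
  ≡-mod-sym {a} {b} (divides-difference p∣a-b) =
    divides-difference (subst (+ p ∣_) (neg-minus a b) (ℤ∣.∣m⇒∣-m p∣a-b))
    where
    neg-minus : ∀ a b → ℤ.- (a - b) ≡ b - a
    neg-minus = solve-∀

  ≡-mod-trans : ∀ {a b c} → a ≡ b mod p → b ≡ c mod p → a ≡ c mod p
  ≡-mod-trans {a} {b} {c} (divides-difference p∣a-b) (divides-difference p∣b-c) =
    divides-difference (subst (+ p ∣_) (telescope a b c) (ℤ∣.∣m∣n⇒∣m+n p∣a-b p∣b-c))
    where
    telescope : ∀ a b c → (a - b) + (b - c) ≡ a - c
    telescope = solve-∀

  +-cong-mod : ∀ {a b c d} → a ≡ b mod p → c ≡ d mod p → a + c ≡ b + d mod p
  +-cong-mod {a} {b} {c} {d} (divides-difference p∣a-b) (divides-difference p∣c-d) =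
    divides-difference (subst (+ p ∣_) (interchange a b c d) (ℤ∣.∣m∣n⇒∣m+n p∣a-b p∣c-d))
    where
    interchange : ∀ a b c d → (a - b) + (c - d) ≡ (a + c) - (b + d)
    interchange = solve-∀

  +-congˡ-mod : ∀ a {b c} → b ≡ c mod p → a + b ≡ a + c mod p
  +-congˡ-mod a = +-cong-mod (≡⇒≡-mod (refl {x = a}))

  +-cancelˡ-mod : ∀ c {a b} → c + a ≡ c + b mod p → a ≡ b mod p
  +-cancelˡ-mod c {a} {b} (divides-difference p∣c+a-[c+b]) =
    divides-difference (subst (+ p ∣_) (cancel c a b) p∣c+a-[c+b])
    where
    cancel : ∀ c a b → (c + a) - (c + b) ≡ a - b
    cancel = solve-∀

  ∣⇒≡0-mod : ∀ {a} → + p ∣ a → a ≡ 0ℤ mod p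
  ∣⇒≡0-mod {a} p∣a = divides-difference (subst (+ p ∣_) (sym (ℤ.+-identityʳ a)) p∣a)

  ∣-resp-≡-mod : ∀ {a b} → a ≡ b mod p → + p ∣ a → + p ∣ b
  ∣-resp-≡-mod {a} {b} (divides-difference p∣a-b) p∣a =
    subst (+ p ∣_) (a-[a-b]≡b a b) (ℤ∣.∣m∣n⇒∣m-n p∣a p∣a-b)
    where
    a-[a-b]≡b : ∀ a b → a - (a - b) ≡ b
    a-[a-b]≡b = solve-∀

  ≡-mod-isEquivalence : IsEquivalence (λ a b → a ≡ b mod p)
  ≡-mod-isEquivalence = record
    { refl = ≡⇒≡-mod refl ; sym = ≡-mod-sym ; trans = ≡-mod-trans }

  ≡-mod-setoid : Setoid 0ℓ 0ℓ
  ≡-mod-setoid = record { isEquivalence = ≡-mod-isEquivalence }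

  module ≡-mod-Reasoning = SetoidReasoning ≡-mod-setoid

  sum-cong-mod : ∀ {n} {f g : Fin n → ℤ} → (∀ i → f i ≡ g i mod p) → sum f ≡ sum g mod p
  sum-cong-mod {zero}  f≡g = ≡⇒≡-mod refl
  sum-cong-mod {suc n} f≡g = +-cong-mod (f≡g zero) (sum-cong-mod (f≡g ∘ suc))

prime∣k*s⇒∣s : ∀ {p k} s → Prime p → 0 ℕ.< k → k ℕ.< p → + p ∣ + k * s → + p ∣ s
prime∣k*s⇒∣s {p} {k} s p-prime 0<k k<p p∣k*s
  with euclidsLemma k ℤ.∣ s ∣ p-prime (subst (p ℕ.∣_) (ℤ.abs-* (+ k) s) (ℤ∣.∣⇒∣ᵤ p∣k*s))
... | inj₁ p∣k = ⊥-elim (ℕ.<⇒≱ k<p (ℕ.∣⇒≤ {{ℕ.>-nonZero 0<k}} p∣k))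
... | inj₂ p∣s = ℤ∣.∣ᵤ⇒∣ p∣s

δ : ℕ → ℕ → ℤ
δ zero    zero    = 1ℤ
δ zero    (suc _) = 0ℤ
δ (suc _) zero    = 0ℤ
δ (suc a) (suc b) = δ a b

δ-sym : ∀ a b → δ a b ≡ δ b a
δ-sym zero    zero    = refl
δ-sym zero    (suc b) = refl
δ-sym (suc a) zero    = refl
δ-sym (suc a) (suc b) = δ-sym a b

δ-refl : ∀ a → δ a a ≡ 1ℤ
δ-refl zero    = refl
δ-refl (suc a) = δ-refl a

δ-≢ : ∀ {a b} → a ≢ b → δ a b ≡ 0ℤ
δ-≢ {zero}  {zero}  a≢b = ⊥-elim (a≢b refl)
δ-≢ {zero}  {suc b} a≢b = refl
δ-≢ {suc a} {zero}  a≢b = refl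
δ-≢ {suc a} {suc b} a≢b = δ-≢ (a≢b ∘ cong suc)

δ-subst : ∀ a b (f : ℕ → ℤ) → δ a b * f a ≡ δ a b * f b
δ-subst zero    zero    f = refl
δ-subst zero    (suc b) f = refl
δ-subst (suc a) zero    f = refl
δ-subst (suc a) (suc b) f = δ-subst a b (f ∘ suc)

δ-weight : ∀ a b x → + b * (δ a b * x) ≡ + a * (δ a b * x)
δ-weight a b x = begin
  + b * (δ a b * x)  ≡⟨ swap (+ b) (δ a b) x ⟩
  δ a b * (+ b * x)  ≡⟨ δ-subst a b (λ c → + c * x) ⟨
  δ a b * (+ a * x)  ≡⟨ swap (δ a b) (+ a) x ⟩
  + a * (δ a b * x)  ∎
  where
  open ≡-Reasoning
  swap : ∀ a b x → a * (b * x) ≡ b * (a * x)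
  swap = solve-∀

∑-δ : ∀ {n} (i : Fin n) (f : Fin n → ℤ) → sum (λ k → δ (toℕ i) (toℕ k) * f k) ≡ f i
∑-δ {suc n} zero f = begin
  1ℤ * f zero + sum (λ k → 0ℤ * f (suc k))  ≡⟨ cong₂ _+_ (ℤ.*-identityˡ (f zero)) (sum-replicate-zero n) ⟩
  f zero + 0ℤ                                ≡⟨ ℤ.+-identityʳ (f zero) ⟩
  f zero                                     ∎
  where open ≡-Reasoning
∑-δ {suc n} (suc i) f = trans (ℤ.+-identityˡ _) (∑-δ i (f ∘ suc))

∑-δ′ : ∀ {n} (i : Fin n) (f : Fin n → ℤ) → sum (λ k → δ (toℕ k) (toℕ i) * f k) ≡ f i
∑-δ′ i f = trans (sum-cong-≗ (λ k → cong (_* f k) (δ-sym (toℕ k) (toℕ i)))) (∑-δ i f)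

δ-< : ∀ {a b} → a ℕ.< b → δ a b ≡ 0ℤ
δ-< {zero}  {suc b} _             = refl
δ-< {suc a} {suc b} (ℕ.s≤s a<b) = δ-< a<b


sum-δ-≤ : ∀ {c N} → c ℕ.≤ N → ∀ x → sum {suc N} (λ k → δ c (toℕ k) * x) ≡ x
sum-δ-≤ {c} {N} c≤N x =
  subst (λ c → sum {suc N} (λ k → δ c (toℕ k) * x) ≡ x) (Fin.toℕ-fromℕ< (ℕ.s≤s c≤N))
        (∑-δ (Fin.fromℕ< (ℕ.s≤s c≤N)) (λ _ → x))

-- Words in two letters

sumWords : ℕ → (List Bool → ℤ) → ℤ
sumWords zero    g = g []
sumWords (suc m) g = sumWords m (g ∘ (false ∷_)) + sumWords m (g ∘ (true ∷_))

sumWords-congᴸ : ∀ m {g h : List Bool → ℤ} →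
                 (∀ w → length w ≡ m → g w ≡ h w) → sumWords m g ≡ sumWords m h
sumWords-congᴸ zero    g≡h = g≡h [] refl
sumWords-congᴸ (suc m) g≡h =
  cong₂ _+_ (sumWords-congᴸ m (λ w → g≡h (false ∷ w) ∘ cong suc))
            (sumWords-congᴸ m (λ w → g≡h (true ∷ w) ∘ cong suc))

sumWords-cong : ∀ m {g h : List Bool → ℤ} → (∀ w → g w ≡ h w) → sumWords m g ≡ sumWords m h
sumWords-cong m g≡h = sumWords-congᴸ m (λ w _ → g≡h w)

sumWords-zero : ∀ m → sumWords m (λ _ → 0ℤ) ≡ 0ℤ
sumWords-zero zero    = refl
sumWords-zero (suc m) = cong₂ _+_ (sumWords-zero m) (sumWords-zero m)

sumWords-distrib-+ : ∀ m (g h : List Bool → ℤ) →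
                     sumWords m (λ w → g w + h w) ≡ sumWords m g + sumWords m h
sumWords-distrib-+ zero    g h = refl
sumWords-distrib-+ (suc m) g h = begin
  sumWords m (λ w → g (false ∷ w) + h (false ∷ w))
    + sumWords m (λ w → g (true ∷ w) + h (true ∷ w))
    ≡⟨ cong₂ _+_ (sumWords-distrib-+ m _ _) (sumWords-distrib-+ m _ _) ⟩
  (sumWords m (g ∘ (false ∷_)) + sumWords m (h ∘ (false ∷_)))
    + (sumWords m (g ∘ (true ∷_)) + sumWords m (h ∘ (true ∷_)))
    ≡⟨ interchange (sumWords m (g ∘ (false ∷_))) (sumWords m (h ∘ (false ∷_))) _ _ ⟩
  sumWords (suc m) g + sumWords (suc m) h ∎
  where
  open ≡-Reasoning
  interchange : ∀ a b c d → (a + b) + (c + d) ≡ (a + c) + (b + d)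
  interchange = solve-∀

sumWords-*ˡ : ∀ m a (g : List Bool → ℤ) → sumWords m (λ w → a * g w) ≡ a * sumWords m g
sumWords-*ˡ zero    a g = refl
sumWords-*ˡ (suc m) a g =
  trans (cong₂ _+_ (sumWords-*ˡ m a _) (sumWords-*ˡ m a _)) (sym (ℤ.*-distribˡ-+ a _ _))

sumWords-sum : ∀ m {n} (f : Fin n → List Bool → ℤ) →
               sumWords m (λ w → sum (λ k → f k w)) ≡ sum (λ k → sumWords m (f k))
sumWords-sum m {zero}  f = sumWords-zero m
sumWords-sum m {suc n} f =
  trans (sumWords-distrib-+ m (f zero) _) (cong (_+_ (sumWords m (f zero))) (sumWords-sum m (f ∘ suc)))

sumWords-∷ʳ : ∀ m (g : List Bool → ℤ) →
              sumWords (suc m) g ≡ sumWords m (λ w → g (w ∷ʳ false) + g (w ∷ʳ true))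
sumWords-∷ʳ zero    g = refl
sumWords-∷ʳ (suc m) g = cong₂ _+_ (sumWords-∷ʳ m (g ∘ (false ∷_))) (sumWords-∷ʳ m (g ∘ (true ∷_)))

rotate : ∀ {A : Set} → List A → List A
rotate []      = []
rotate (a ∷ w) = w ∷ʳ a

sumWords-rotate : ∀ m (g : List Bool → ℤ) → sumWords m (g ∘ rotate) ≡ sumWords m g
sumWords-rotate zero    g = refl
sumWords-rotate (suc m) g =
  trans (sym (sumWords-distrib-+ m (λ w → g (w ∷ʳ false)) (λ w → g (w ∷ʳ true))))
        (sym (sumWords-∷ʳ m g))

trues : List Bool → ℕ
trues []          = 0
trues (false ∷ w) = trues w
trues (true ∷ w)  = suc (trues w)

trues-∷ʳ : ∀ w b → trues (w ∷ʳ b) ≡ trues (b ∷ w)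
trues-∷ʳ []          b     = refl
trues-∷ʳ (false ∷ w) false = trues-∷ʳ w false
trues-∷ʳ (false ∷ w) true  = trues-∷ʳ w true
trues-∷ʳ (true ∷ w)  false = cong suc (trues-∷ʳ w false)
trues-∷ʳ (true ∷ w)  true  = cong suc (trues-∷ʳ w true)

trues-rotate : ∀ w → trues (rotate w) ≡ trues w
trues-rotate []      = refl
trues-rotate (b ∷ w) = trues-∷ʳ w b

trues≤length : ∀ w → trues w ℕ.≤ length w
trues≤length []          = ℕ.z≤n
trues≤length (false ∷ w) = ℕ.m≤n⇒m≤1+n (trues≤length w)
trues≤length (true ∷ w)  = ℕ.s≤s (trues≤length w)

headBit : List Bool → ℤ
headBit []          = 0ℤ
headBit (false ∷ _) = 0ℤ
headBit (true ∷ _)  = 1ℤ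

rotationHeads : ℕ → List Bool → ℤ
rotationHeads zero    w = 0ℤ
rotationHeads (suc r) w = headBit w + rotationHeads r (rotate w)

rotationHeads-++ : ∀ w u → rotationHeads (length w) (w ++ u) ≡ + trues w
rotationHeads-++ []      u = refl
rotationHeads-++ (b ∷ w) u = begin
  h + rotationHeads (length w) ((w ++ u) ∷ʳ b)
    ≡⟨ cong (λ v → h + rotationHeads (length w) v) (List.++-assoc w u (b ∷ [])) ⟩
  h + rotationHeads (length w) (w ++ u ∷ʳ b)    ≡⟨ cong (_+_ h) (rotationHeads-++ w (u ∷ʳ b)) ⟩
  h + + trues w                                  ≡⟨ headBit-+-trues b ⟩
  + trues (b ∷ w)                                ∎
  where
  open ≡-Reasoning
  h = headBit (b ∷ w ++ u)
  headBit-+-trues : ∀ c → headBit (c ∷ w ++ u) + + trues w ≡ + trues (c ∷ w)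
  headBit-+-trues false = ℤ.+-identityˡ (+ trues w)
  headBit-+-trues true  = refl

rotationHeads-length : ∀ w → rotationHeads (length w) w ≡ + trues w
rotationHeads-length w = trans (cong (rotationHeads (length w)) (sym (List.++-identityʳ w)))
                               (rotationHeads-++ w [])

RotationInvariant : (List Bool → ℤ) → Set
RotationInvariant g = ∀ w → g (rotate w) ≡ g w

sumWords-rotationHeads : ∀ m {g} → RotationInvariant g → ∀ r →
  sumWords m (λ w → rotationHeads r w * g w) ≡ + r * sumWords m (λ w → headBit w * g w)
sumWords-rotationHeads m         g-inv zero    = sumWords-zero m
sumWords-rotationHeads m {g} g-inv (suc r) = begin
  sumWords m (λ w → (headBit w + rotationHeads r (rotate w)) * g w)
    ≡⟨ sumWords-cong m (λ w → trans (ℤ.*-distribʳ-+ (g w) (headBit w) _)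
                                     (cong (λ x → headBit w * g w + rotationHeads r (rotate w) * x) (sym (g-inv w)))) ⟩
  sumWords m (λ w → headBit w * g w + rotationHeads r (rotate w) * g (rotate w))
    ≡⟨ sumWords-distrib-+ m (λ w → headBit w * g w) _ ⟩
  H + sumWords m ((λ v → rotationHeads r v * g v) ∘ rotate)
    ≡⟨ cong (_+_ H) (sumWords-rotate m (λ v → rotationHeads r v * g v)) ⟩
  H + sumWords m (λ v → rotationHeads r v * g v)
    ≡⟨ cong (_+_ H) (sumWords-rotationHeads m g-inv r) ⟩
  H + + r * H
    ≡⟨ h+r*h≡[1+r]*h H (+ r) ⟩
  + suc r * H ∎
  where
  open ≡-Reasoning
  H = sumWords m (λ w → headBit w * g w)
  h+r*h≡[1+r]*h : ∀ h r → h + r * h ≡ (1ℤ + r) * h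
  h+r*h≡[1+r]*h = solve-∀

sumWords-trues : ∀ m {g} → RotationInvariant g →
  sumWords m (λ w → + trues w * g w) ≡ + m * sumWords m (λ w → headBit w * g w)
sumWords-trues m {g} g-inv =
  trans (sumWords-congᴸ m (λ w |w|≡m → cong (_* g w) (trues≡rotationHeads w |w|≡m)))
        (sumWords-rotationHeads m g-inv m)
  where
  trues≡rotationHeads : ∀ w → length w ≡ m → + trues w ≡ rotationHeads m w
  trues≡rotationHeads w refl = sym (rotationHeads-length w)

sumWords-trues≡0 : ∀ m (g : List Bool → ℤ) →
                   sumWords m (λ w → δ (trues w) 0 * g w) ≡ g (replicate m false)
sumWords-trues≡0 zero    g = ℤ.*-identityˡ (g [])
sumWords-trues≡0 (suc m) g =
  trans (cong₂ _+_ (sumWords-trues≡0 m (g ∘ (false ∷_))) (sumWords-zero m))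
        (ℤ.+-identityʳ _)

sumWords-trues≡length : ∀ m (g : List Bool → ℤ) →
                        sumWords m (λ w → δ (trues w) m * g w) ≡ g (replicate m true)
sumWords-trues≡length zero    g = ℤ.*-identityˡ (g [])
sumWords-trues≡length (suc m) g =
  trans (cong₂ _+_ no-false-word (sumWords-trues≡length m (g ∘ (true ∷_))))
        (ℤ.+-identityˡ _)
  where
  no-false-word : sumWords m (λ w → δ (trues w) (suc m) * g (false ∷ w)) ≡ 0ℤ
  no-false-word = trans (sumWords-congᴸ m (λ w |w|≡m →
                    cong (_* g (false ∷ w)) (δ-< (ℕ.s≤s (subst (trues w ℕ.≤_) |w|≡m (trues≤length w))))))
                    (sumWords-zero m)

sumWords-by-trues : ∀ m (g : List Bool → ℤ) →
  sumWords m g ≡ sum {suc m} (λ k → sumWords m (λ w → δ (trues w) (toℕ k) * g w))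
sumWords-by-trues m g =
  trans (sumWords-congᴸ m (λ w |w|≡m →
           sym (sum-δ-≤ {N = m} (subst (trues w ℕ.≤_) |w|≡m (trues≤length w)) (g w))))
        (sumWords-sum m {suc m} (λ k w → δ (trues w) (toℕ k) * g w))

-- The class of words with exactly k trues is closed under rotation, and counting the pairs
-- (word, position of a true) in two ways gives k · S = p · (sum over the class weighted by headBit).
p∣sumWords-trues≡k : ∀ {p k} (g : List Bool → ℤ) → Prime p → RotationInvariant g →
                  0 ℕ.< k → k ℕ.< p → + p ∣ sumWords p (λ w → δ (trues w) k * g w)
p∣sumWords-trues≡k {p} {k} g p-prime g-inv 0<k k<p =
  prime∣k*s⇒∣s (sumWords p class) p-prime 0<k k<p
    (divides (sumWords p (λ w → headBit w * class w)) k*S≡H*p)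
  where
  class : List Bool → ℤ
  class w = δ (trues w) k * g w
  class-inv : RotationInvariant class
  class-inv w = cong₂ (λ t x → δ t k * x) (trues-rotate w) (g-inv w)
  k*S≡H*p : + k * sumWords p class ≡ sumWords p (λ w → headBit w * class w) * + p
  k*S≡H*p = begin
    + k * sumWords p class                    ≡⟨ sumWords-*ˡ p (+ k) class ⟨
    sumWords p (λ w → + k * class w)          ≡⟨ sumWords-cong p (λ w → δ-weight (trues w) k (g w)) ⟩
    sumWords p (λ w → + trues w * class w)    ≡⟨ sumWords-trues p class-inv ⟩
    + p * sumWords p (λ w → headBit w * class w) ≡⟨ ℤ.*-comm (+ p) _ ⟩
    sumWords p (λ w → headBit w * class w) * + p ∎
    where open ≡-Reasoning

sumWords-≡-mod : ∀ {p} (g : List Bool → ℤ) → Prime p → RotationInvariant g →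
                 sumWords p g ≡ g (replicate p false) + g (replicate p true) mod p
sumWords-≡-mod {p@(suc (suc r))} g p-prime g-inv = begin
  sumWords p g
    ≡⟨ sumWords-by-trues p g ⟩
  withTrues 0 + sum {p} (λ k → withTrues (suc (toℕ k)))
    ≡⟨ cong (_+_ (withTrues 0)) (sum-init-last {suc r} (λ k → withTrues (suc (toℕ k)))) ⟩
  withTrues 0 + (sum {suc r} (λ k → withTrues (suc (toℕ (Fin.inject₁ k))))
                 + withTrues (suc (toℕ (Fin.fromℕ (suc r)))))
    ≈⟨ +-congˡ-mod (withTrues 0)
         (+-cong-mod mixed≡0 (≡⇒≡-mod (cong (withTrues ∘ suc) (Fin.toℕ-fromℕ (suc r))))) ⟩
  withTrues 0 + (0ℤ + withTrues p)
    ≡⟨ cong₂ _+_ (sumWords-trues≡0 p g) (trans (ℤ.+-identityˡ _) (sumWords-trues≡length p g)) ⟩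
  g (replicate p false) + g (replicate p true) ∎
  where
  open ≡-mod-Reasoning
  withTrues : ℕ → ℤ
  withTrues k = sumWords p (λ w → δ (trues w) k * g w)
  mixed≡0 : sum {suc r} (λ k → withTrues (suc (toℕ (Fin.inject₁ k)))) ≡ 0ℤ mod p
  mixed≡0 = ≡-mod-trans
    (sum-cong-mod (λ k → ∣⇒≡0-mod
      (p∣sumWords-trues≡k g p-prime g-inv (ℕ.s≤s ℕ.z≤n) (ℕ.s≤s (Fin.inject₁ℕ< k)))))
    (≡⇒≡-mod (sum-replicate-zero (suc r)))
-- Traces on semirings

record Trace {c ℓ} (R : Semiring c ℓ) : Set (c ⊔ ℓ) where
  open Semiring R using (Carrier) renaming (_≈_ to _≈ᴿ_; _+_ to _⊕_; _*_ to _⊛_)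
  field
    tr        : Carrier → ℤ
    tr-cong   : ∀ {a b} → a ≈ᴿ b → tr a ≡ tr b
    tr-homo-+ : ∀ a b → tr (a ⊕ b) ≡ tr a + tr b
    tr-comm   : ∀ a b → tr (a ⊛ b) ≡ tr (b ⊛ a)

module TraceProperties {c ℓ} {R : Semiring c ℓ} (T : Trace R) where
  open Semiring R
    using (Carrier; 0#; 1#; *-assoc; *-congˡ; *-congʳ; distribˡ; distribʳ; *-identityˡ; *-identityʳ;
           +-identityʳ; zeroˡ)
    renaming (_≈_ to _≈ᴿ_; _+_ to _⊕_; _*_ to _⊛_; sym to ≈-sym; trans to ≈-trans)
  open Trace T
  open import Algebra.Properties.Semiring.Exp R public using (_^_)
  module ∑ᴿ = Algebra.Properties.Semiring.Sum R

  tr-0# : tr 0# ≡ 0ℤ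
  tr-0# = ℤ+.∙-cancelˡ (tr 0#) (tr 0#) 0ℤ (begin
    tr 0# + tr 0#  ≡⟨ tr-homo-+ 0# 0# ⟨
    tr (0# ⊕ 0#)   ≡⟨ tr-cong (+-identityʳ 0#) ⟩
    tr 0#          ≡⟨ ℤ.+-identityʳ (tr 0#) ⟨
    tr 0# + 0ℤ     ∎)
    where open ≡-Reasoning

  module _ (x y : Carrier) where

    letter : Bool → Carrier
    letter false = x
    letter true  = y

    word : List Bool → Carrier
    word []      = 1#
    word (b ∷ w) = letter b ⊛ word w

    tr-*-^-expand : ∀ m a → tr (a ⊛ (x ⊕ y) ^ m) ≡ sumWords m (λ w → tr (a ⊛ word w))
    tr-*-^-expand zero    a = refl
    tr-*-^-expand (suc m) a = begin
      tr (a ⊛ ((x ⊕ y) ⊛ s))                    ≡⟨ tr-cong (≈-trans (≈-sym (*-assoc a (x ⊕ y) s))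
                                                     (≈-trans (*-congʳ (distribˡ a x y)) (distribʳ s (a ⊛ x) (a ⊛ y)))) ⟩
      tr ((a ⊛ x) ⊛ s ⊕ (a ⊛ y) ⊛ s)            ≡⟨ tr-homo-+ _ _ ⟩
      tr ((a ⊛ x) ⊛ s) + tr ((a ⊛ y) ⊛ s)       ≡⟨ cong₂ _+_ (expand-after x) (expand-after y) ⟩
      sumWords (suc m) (λ w → tr (a ⊛ word w))  ∎
      where
      open ≡-Reasoning
      s = (x ⊕ y) ^ m
      expand-after : ∀ z → tr ((a ⊛ z) ⊛ s) ≡ sumWords m (λ w → tr (a ⊛ (z ⊛ word w)))
      expand-after z = trans (tr-*-^-expand m (a ⊛ z)) (sumWords-cong m (λ w → tr-cong (*-assoc a z (word w))))

    tr-^-expand : ∀ m → tr ((x ⊕ y) ^ m) ≡ sumWords m (tr ∘ word)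
    tr-^-expand m = trans (tr-cong (≈-sym (*-identityˡ _)))
                          (trans (tr-*-^-expand m 1#) (sumWords-cong m (λ w → tr-cong (*-identityˡ (word w)))))

    word-∷ʳ : ∀ w b → word (w ∷ʳ b) ≈ᴿ word w ⊛ letter b
    word-∷ʳ []      b = ≈-trans (*-identityʳ (letter b)) (≈-sym (*-identityˡ (letter b)))
    word-∷ʳ (c ∷ w) b = ≈-trans (*-congˡ (word-∷ʳ w b)) (≈-sym (*-assoc (letter c) (word w) (letter b)))

    tr-word-rotate : RotationInvariant (tr ∘ word)
    tr-word-rotate []      = refl
    tr-word-rotate (b ∷ w) = trans (tr-cong (word-∷ʳ w b)) (tr-comm (word w) (letter b))

    word-replicate : ∀ b m → word (replicate m b) ≡ letter b ^ m
    word-replicate b zero    = refl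
    word-replicate b (suc m) = cong (letter b ⊛_) (word-replicate b m)

    tr-+-^ : ∀ {p} → Prime p → tr ((x ⊕ y) ^ p) ≡ tr (x ^ p) + tr (y ^ p) mod p
    tr-+-^ {p} p-prime = begin
      tr ((x ⊕ y) ^ p)                                        ≡⟨ tr-^-expand p ⟩
      sumWords p (tr ∘ word)                                  ≈⟨ sumWords-≡-mod (tr ∘ word) p-prime tr-word-rotate ⟩
      tr (word (replicate p false)) + tr (word (replicate p true))
        ≡⟨ cong₂ (λ u v → tr u + tr v) (word-replicate false p) (word-replicate true p) ⟩
      tr (x ^ p) + tr (y ^ p)                                 ∎
      where open ≡-mod-Reasoning

  tr-sum-^ : ∀ {p} → Prime p → ∀ {N} (X : Fin N → Carrier) →
             tr (∑ᴿ.sum X ^ p) ≡ sum (λ i → tr (X i ^ p)) mod p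
  tr-sum-^ {suc q} p-prime {zero}  X = ≡⇒≡-mod (trans (tr-cong (zeroˡ _)) tr-0#)
  tr-sum-^ {p}     p-prime {suc N} X =
    ≡-mod-trans (tr-+-^ (X zero) (∑ᴿ.sum (X ∘ suc)) p-prime)
                (+-congˡ-mod (tr (X zero ^ p)) (tr-sum-^ p-prime (X ∘ suc)))

ℤ-trace : Trace ℤ.+-*-semiring
ℤ-trace = record { tr = λ a → a ; tr-cong = λ a≡b → a≡b ; tr-homo-+ = λ _ _ → refl ; tr-comm = ℤ.*-comm }

fermat : ∀ {p} → Prime p → ∀ a → a ℤ.^ p ≡ a mod p
fermat {p@(suc q)} p-prime = go
  where
  open TraceProperties ℤ-trace using (_^_; tr-+-^)
  ^≡ℤ^ : ∀ a m → a ^ m ≡ a ℤ.^ m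
  ^≡ℤ^ a zero    = refl
  ^≡ℤ^ a (suc m) = cong (a *_) (^≡ℤ^ a m)
  1+a-^ : ∀ a → (1ℤ + a) ℤ.^ p ≡ 1ℤ + a ℤ.^ p mod p
  1+a-^ a = begin
    (1ℤ + a) ℤ.^ p    ≡⟨ ^≡ℤ^ (1ℤ + a) p ⟨
    (1ℤ + a) ^ p      ≈⟨ tr-+-^ 1ℤ a p-prime ⟩
    1ℤ ^ p + a ^ p    ≡⟨ cong₂ _+_ (trans (^≡ℤ^ 1ℤ p) (ℤ.^-zeroˡ p)) (^≡ℤ^ a p) ⟩
    1ℤ + a ℤ.^ p      ∎
    where open ≡-mod-Reasoning
  up : ∀ a → a ℤ.^ p ≡ a mod p → (1ℤ + a) ℤ.^ p ≡ 1ℤ + a mod p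
  up a h = ≡-mod-trans (1+a-^ a) (+-congˡ-mod 1ℤ h)
  down : ∀ a → (1ℤ + a) ℤ.^ p ≡ 1ℤ + a mod p → a ℤ.^ p ≡ a mod p
  down a h = +-cancelˡ-mod 1ℤ (≡-mod-trans (≡-mod-sym (1+a-^ a)) h)
  go : ∀ a → a ℤ.^ p ≡ a mod p
  go (+ zero)          = ≡⇒≡-mod refl
  go (+ suc n)         = up (+ n) (go (+ n))
  go ℤ.-[1+ zero ]     = down ℤ.-[1+ zero ] (go (+ zero))
  go ℤ.-[1+ suc n ]    = down ℤ.-[1+ suc n ] (go ℤ.-[1+ n ])
-- Integer matrices

Mat : ℕ → Set
Mat n = Fin n → Fin n → ℤ

module _ {n : ℕ} where

  infix  4 _≈ᴹ_
  infixl 6 _+ᴹ_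
  infixl 7 _*ᴹ_

  _≈ᴹ_ : Mat n → Mat n → Set
  A ≈ᴹ B = ∀ i j → A i j ≡ B i j

  _+ᴹ_ : Mat n → Mat n → Mat n
  (A +ᴹ B) i j = A i j + B i j

  _*ᴹ_ : Mat n → Mat n → Mat n
  (A *ᴹ B) i j = sum (λ k → A i k * B k j)

  0ᴹ : Mat n
  0ᴹ _ _ = 0ℤ

  1ᴹ : Mat n
  1ᴹ i j = δ (toℕ i) (toℕ j)

  trace : Mat n → ℤ
  trace A = sum (λ i → A i i)

  *ᴹ-assoc : ∀ A B C → (A *ᴹ B) *ᴹ C ≈ᴹ A *ᴹ (B *ᴹ C)
  *ᴹ-assoc A B C i j = begin
    sum (λ l → sum (λ k → A i k * B k l) * C l j)
      ≡⟨ sum-cong-≗ (λ l → *-distribʳ-sum (C l j) (λ k → A i k * B k l)) ⟩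
    sum (λ l → sum (λ k → A i k * B k l * C l j))
      ≡⟨ ∑-comm (λ l k → A i k * B k l * C l j) ⟩
    sum (λ k → sum (λ l → A i k * B k l * C l j))
      ≡⟨ sum-cong-≗ (λ k → sum-cong-≗ (λ l → ℤ.*-assoc (A i k) (B k l) (C l j))) ⟩
    sum (λ k → sum (λ l → A i k * (B k l * C l j)))
      ≡⟨ sum-cong-≗ (λ k → *-distribˡ-sum (A i k) (λ l → B k l * C l j)) ⟨
    sum (λ k → A i k * sum (λ l → B k l * C l j))
      ∎
    where open ≡-Reasoning

Mat-semiring : ℕ → Semiring 0ℓ 0ℓ
Mat-semiring n = record
  { Carrier = Mat n ; _≈_ = _≈ᴹ_ ; _+_ = _+ᴹ_ ; _*_ = _*ᴹ_ ; 0# = 0ᴹ ; 1# = 1ᴹ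
  ; isSemiring = record
    { isSemiringWithoutAnnihilatingZero = record
      { +-isCommutativeMonoid = Pointwise.isCommutativeMonoid (Fin n)
                                  (Pointwise.isCommutativeMonoid (Fin n) ℤ.+-0-isCommutativeMonoid)
      ; *-cong     = λ A≈B C≈D i j → sum-cong-≗ (λ k → cong₂ _*_ (A≈B i k) (C≈D k j))
      ; *-assoc    = *ᴹ-assoc
      ; *-identity = (λ A i j → ∑-δ i (λ k → A k j))
                   , (λ A i j → trans (sum-cong-≗ (λ k → ℤ.*-comm (A i k) _)) (∑-δ′ j (A i)))
      ; distrib    = (λ A B C i j → trans (sum-cong-≗ (λ k → ℤ.*-distribˡ-+ (A i k) (B k j) (C k j)))
                                          (∑-distrib-+ (λ k → A i k * B k j) (λ k → A i k * C k j)))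
                   , (λ A B C i j → trans (sum-cong-≗ (λ k → ℤ.*-distribʳ-+ (A k j) (B i k) (C i k)))
                                          (∑-distrib-+ (λ k → B i k * A k j) (λ k → C i k * A k j)))
      }
    ; zero = (λ A i j → sum-replicate-zero n)
           , (λ A i j → trans (sum-cong-≗ (λ k → ℤ.*-zeroʳ (A i k))) (sum-replicate-zero n))
    }
  }

Mat-trace : ∀ n → Trace (Mat-semiring n)
Mat-trace n = record
  { tr        = trace
  ; tr-cong   = λ A≈B → sum-cong-≗ (λ i → A≈B i i)
  ; tr-homo-+ = λ A B → ∑-distrib-+ (λ i → A i i) (λ i → B i i)
  ; tr-comm   = λ A B → trans (∑-comm (λ i k → A i k * B k i))
                              (sum-cong-≗ (λ k → sum-cong-≗ (λ i → ℤ.*-comm (A i k) (B k i))))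
  }

module _ {n : ℕ} where
  open TraceProperties (Mat-trace n) using (_^_; tr-sum-^)
  open import Algebra.Properties.Semiring.Exp (Mat-semiring n) using (^-congˡ)
  module ∑ᴹ = Algebra.Properties.Semiring.Sum (Mat-semiring n)

  sumᴹ-entry : ∀ {N} (X : Fin N → Mat n) i j → ∑ᴹ.sum X i j ≡ sum (λ t → X t i j)
  sumᴹ-entry {zero}  X i j = refl
  sumᴹ-entry {suc N} X i j = cong (_+_ (X zero i j)) (sumᴹ-entry (X ∘ suc) i j)

  row : Mat n → Fin n → Mat n
  row A i l k = δ (toℕ i) (toℕ l) * A i k

  sum-row : ∀ A → A ≈ᴹ ∑ᴹ.sum (row A)
  sum-row A l k = sym (trans (sumᴹ-entry (row A) l k) (∑-δ′ l (λ i → A i k)))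

  row-^ : ∀ A i m l k → (row A i ^ suc m) l k ≡ A i i ℤ.^ m * row A i l k
  row-^ A i zero l k =
    trans (Semiring.*-identityʳ (Mat-semiring n) (row A i) l k) (sym (ℤ.*-identityˡ (row A i l k)))
  row-^ A i (suc m) l k = begin
    sum (λ j → row A i l j * (row A i ^ suc m) j k)
      ≡⟨ sum-cong-≗ (λ j → cong (row A i l j *_) (row-^ A i m j k)) ⟩
    sum (λ j → row A i l j * (aᵐ * (δ (toℕ i) (toℕ j) * A i k)))
      ≡⟨ sum-cong-≗ (λ j → pull-δ (row A i l j) aᵐ (δ (toℕ i) (toℕ j)) (A i k)) ⟩
    sum (λ j → δ (toℕ i) (toℕ j) * (row A i l j * (aᵐ * A i k)))
      ≡⟨ ∑-δ i (λ j → row A i l j * (aᵐ * A i k)) ⟩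
    δ (toℕ i) (toℕ l) * A i i * (aᵐ * A i k)
      ≡⟨ regroup (δ (toℕ i) (toℕ l)) (A i i) aᵐ (A i k) ⟩
    A i i * aᵐ * (δ (toℕ i) (toℕ l) * A i k)
      ∎
    where
    open ≡-Reasoning
    aᵐ = A i i ℤ.^ m
    pull-δ : ∀ r a d x → r * (a * (d * x)) ≡ d * (r * (a * x))
    pull-δ = solve-∀
    regroup : ∀ d b a x → d * b * (a * x) ≡ b * a * (d * x)
    regroup = solve-∀

  trace-row-^ : ∀ A i m → trace (row A i ^ suc m) ≡ A i i ℤ.^ suc m
  trace-row-^ A i m = begin
    sum (λ l → (row A i ^ suc m) l l)
      ≡⟨ sum-cong-≗ (λ l → trans (row-^ A i m l l) (swap aᵐ (δ (toℕ i) (toℕ l)) (A i l))) ⟩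
    sum (λ l → δ (toℕ i) (toℕ l) * (aᵐ * A i l))  ≡⟨ ∑-δ i (λ l → aᵐ * A i l) ⟩
    aᵐ * A i i                                     ≡⟨ ℤ.*-comm aᵐ (A i i) ⟩
    A i i * aᵐ                                     ∎
    where
    open ≡-Reasoning
    aᵐ = A i i ℤ.^ m
    swap : ∀ a d x → a * (d * x) ≡ d * (a * x)
    swap = solve-∀

  trace-^-≡-mod : ∀ {p} → Prime p → ∀ A → trace (A ^ p) ≡ trace A mod p
  trace-^-≡-mod {p@(suc q)} p-prime A = begin
    trace (A ^ p)                          ≡⟨ Trace.tr-cong (Mat-trace n) (^-congˡ p (sum-row A)) ⟩
    trace (∑ᴹ.sum (row A) ^ p)             ≈⟨ tr-sum-^ p-prime (row A) ⟩
    sum (λ i → trace (row A i ^ p))        ≡⟨ sum-cong-≗ (λ i → trace-row-^ A i q) ⟩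
    sum (λ i → A i i ℤ.^ p)                ≈⟨ sum-cong-mod (λ i → fermat p-prime (A i i)) ⟩
    trace A                                ∎
    where open ≡-mod-Reasoning

-- Number fields

toℚᵘ-ι : ∀ a → ℚ.toℚᵘ (ι a) ℚᵘ.≃ mkℚᵘ a 0
toℚᵘ-ι a = ℚ.toℚᵘ-fromℚᵘ (mkℚᵘ a 0)

ι-injective : ∀ {a b} → ι a ≡ ι b → a ≡ b
ι-injective {a} {b} eq with ℚᵘ.≃-trans (ℚᵘ.≃-sym (toℚᵘ-ι a)) (ℚᵘ.≃-trans (ℚ.toℚᵘ-cong eq) (toℚᵘ-ι b))
... | *≡* a*1≡b*1 = trans (sym (ℤ.*-identityʳ a)) (trans a*1≡b*1 (ℤ.*-identityʳ b))

ι-homo-+ : ∀ a b → ι (a + b) ≡ ι a ℚ.+ ι b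
ι-homo-+ a b = ℚ.toℚᵘ-injective (begin
  ℚ.toℚᵘ (ι (a + b))                ≈⟨ toℚᵘ-ι (a + b) ⟩
  mkℚᵘ (a + b) 0                    ≈⟨ *≡* (+-over-1 a b) ⟩
  mkℚᵘ a 0 ℚᵘ.+ mkℚᵘ b 0            ≈⟨ ℚᵘ.+-cong (toℚᵘ-ι a) (toℚᵘ-ι b) ⟨
  ℚ.toℚᵘ (ι a) ℚᵘ.+ ℚ.toℚᵘ (ι b)    ≈⟨ ℚ.toℚᵘ-homo-+ (ι a) (ι b) ⟨
  ℚ.toℚᵘ (ι a ℚ.+ ι b)              ∎)
  where
  open ℚᵘ.≃-Reasoning
  +-over-1 : ∀ a b → (a + b) * + 1 ≡ (a * + 1 + b * + 1) * + 1
  +-over-1 = solve-∀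

ι-homo-* : ∀ a b → ι (a * b) ≡ ι a ℚ.* ι b
ι-homo-* a b = ℚ.toℚᵘ-injective (begin
  ℚ.toℚᵘ (ι (a * b))                ≈⟨ toℚᵘ-ι (a * b) ⟩
  mkℚᵘ (a * b) 0                    ≈⟨ *≡* refl ⟩
  mkℚᵘ a 0 ℚᵘ.* mkℚᵘ b 0            ≈⟨ ℚᵘ.*-cong (toℚᵘ-ι a) (toℚᵘ-ι b) ⟨
  ℚ.toℚᵘ (ι a) ℚᵘ.* ℚ.toℚᵘ (ι b)    ≈⟨ ℚ.toℚᵘ-homo-* (ι a) (ι b) ⟨
  ℚ.toℚᵘ (ι a ℚ.* ι b)              ∎)
  where open ℚᵘ.≃-Reasoning

Σℚ-cong : ∀ {n} {f g : Fin n → ℚ} → (∀ i → f i ≡ g i) → Σℚ f ≡ Σℚ g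
Σℚ-cong {zero}  f≡g = refl
Σℚ-cong {suc n} f≡g = cong₂ ℚ._+_ (f≡g zero) (Σℚ-cong (f≡g ∘ suc))

Σℚ-ι : ∀ {n} (f : Fin n → ℤ) → Σℚ (ι ∘ f) ≡ ι (sum f)
Σℚ-ι {zero}  f = refl
Σℚ-ι {suc n} f = trans (cong (ℚ._+_ (ι (f zero))) (Σℚ-ι (f ∘ suc))) (sym (ι-homo-+ (f zero) _))

module NumberFieldTrace {n} (K : NumberField n) where
  open NumberField K
  open import Algebra.Properties.Semiring.Exp (Mat-semiring n) using (_^_)

  -- Column k holds the coordinates of ιV x · e_k.
  mulMatrix : (Fin n → ℤ) → Mat n
  mulMatrix x l k = sum (λ j → x j * c j k l)

  mul-congʳ : ∀ a {y y′} → y ≈ y′ → mul a y ≈ mul a y′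
  mul-congʳ a y≈y′ l = Σℚ-cong (λ j → Σℚ-cong (λ k → cong (λ t → a j ℚ.* (t ℚ.* ι (c j k l))) (y≈y′ k)))

  mul-ιV : ∀ x z → mul (ιV x) (ιV z) ≈ ιV (λ l → sum (λ k → mulMatrix x l k * z k))
  mul-ιV x z l = begin
    Σℚ (λ j → Σℚ (λ k → ι (x j) ℚ.* (ι (z k) ℚ.* ι (c j k l))))
      ≡⟨ Σℚ-cong (λ j → Σℚ-cong (λ k →
           sym (trans (ι-homo-* (x j) _) (cong (ℚ._*_ (ι (x j))) (ι-homo-* (z k) _))))) ⟩
    Σℚ (λ j → Σℚ (λ k → ι (x j * (z k * c j k l))))
      ≡⟨ Σℚ-cong (λ j → Σℚ-ι (λ k → x j * (z k * c j k l))) ⟩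
    Σℚ (λ j → ι (sum (λ k → x j * (z k * c j k l))))
      ≡⟨ Σℚ-ι (λ j → sum (λ k → x j * (z k * c j k l))) ⟩
    ι (sum (λ j → sum (λ k → x j * (z k * c j k l))))
      ≡⟨ cong ι (∑-comm (λ j k → x j * (z k * c j k l))) ⟩
    ι (sum (λ k → sum (λ j → x j * (z k * c j k l))))
      ≡⟨ cong ι (sum-cong-≗ (λ k → trans (sum-cong-≗ (λ j → swap (x j) (z k) (c j k l)))
                                         (sym (*-distribʳ-sum (z k) (λ j → x j * c j k l))))) ⟩
    ι (sum (λ k → mulMatrix x l k * z k))  ∎
    where
    open ≡-Reasoning
    swap : ∀ a b d → a * (b * d) ≡ a * d * b
    swap = solve-∀

  basis≈column-1ᴹ : ∀ i → basis i ≈ ιV (λ l → 1ᴹ l i)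
  basis≈column-1ᴹ i j with i Fin.≟ j
  ... | yes refl = cong ι (sym (δ-refl (toℕ i)))
  ... | no  i≢j  = cong ι (sym (δ-≢ (i≢j ∘ sym ∘ Fin.toℕ-injective)))

  mul-basis : ∀ x i → mul (ιV x) (basis i) ≈ ιV (λ l → mulMatrix x l i)
  mul-basis x i l = trans (mul-congʳ (ιV x) (basis≈column-1ᴹ i) l)
                          (trans (mul-ιV x (λ k → 1ᴹ k i) l)
                                 (cong ι (Semiring.*-identityʳ (Mat-semiring n) (mulMatrix x) l i)))

  pow-mul-basis : ∀ x m i → mul (pow (ιV x) m) (basis i) ≈ ιV (λ l → (mulMatrix x ^ m) l i)
  pow-mul-basis x zero    i l = trans (mul-identityˡ (basis i) l) (basis≈column-1ᴹ i l)
  pow-mul-basis x (suc m) i l =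
    trans (mul-assoc (ιV x) (pow (ιV x) m) (basis i) l)
          (trans (mul-congʳ (ιV x) (pow-mul-basis x m i) l) (mul-ιV x (λ k → (mulMatrix x ^ m) k i) l))

  Tr-by-columns : ∀ y (B : Mat n) → (∀ i → mul y (basis i) ≈ ιV (λ l → B l i)) → Tr y ≡ ι (trace B)
  Tr-by-columns y B columns = trans (Σℚ-cong (λ i → columns i i)) (Σℚ-ι (λ i → B i i))

  Tr-ιV : ∀ x → Tr (ιV x) ≡ ι (trace (mulMatrix x))
  Tr-ιV x = Tr-by-columns (ιV x) (mulMatrix x) (mul-basis x)

  Tr-pow-ιV : ∀ x m → Tr (pow (ιV x) m) ≡ ι (trace (mulMatrix x ^ m))
  Tr-pow-ιV x m = Tr-by-columns (pow (ιV x) m) (mulMatrix x ^ m) (pow-mul-basis x m)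

module _ {p : ℕ} where

  ∣⇒ι-multiple : ∀ {q t} → q ≡ ι t → + p ∣ t → ∃ λ k → q ≡ ι (+ p * k)
  ∣⇒ι-multiple q≡ιt (divides k t≡k*p) = k , trans q≡ιt (cong ι (trans t≡k*p (ℤ.*-comm k (+ p))))

  ι-multiple⇒∣ : ∀ {q t} → q ≡ ι t → (∃ λ k → q ≡ ι (+ p * k)) → + p ∣ t
  ι-multiple⇒∣ q≡ιt (k , q≡ιpk) = divides k (trans (ι-injective (trans (sym q≡ιt) q≡ιpk)) (ℤ.*-comm (+ p) k))

lemma1 : ∀ {n : ℕ} (K : NumberField n) (p : ℕ) → Prime p →
           let open NumberField K in
           ((∀ (x : Fin n → ℤ) → ∃ λ (k : ℤ) → Tr (ιV x) ≡ ι (+ p * k)) →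
            (∀ (x : Fin n → ℤ) → ∃ λ (k : ℤ) → Tr (pow (ιV x) p) ≡ ι (+ p * k)))
           × ((∀ (x : Fin n → ℤ) → ∃ λ (k : ℤ) → Tr (pow (ιV x) p) ≡ ι (+ p * k)) →
            (∀ (x : Fin n → ℤ) → ∃ λ (k : ℤ) → Tr (ιV x) ≡ ι (+ p * k)))
lemma1 K p p-prime =
    (λ Tr-divisible x →
       ∣⇒ι-multiple (Tr-pow-ιV x p)
         (∣-resp-≡-mod (≡-mod-sym (trace-^-≡-mod p-prime (mulMatrix x)))
           (ι-multiple⇒∣ (Tr-ιV x) (Tr-divisible x))))
  , (λ Tr-pow-divisible x →
       ∣⇒ι-multiple (Tr-ιV x)
         (∣-resp-≡-mod (trace-^-≡-mod p-prime (mulMatrix x))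
           (ι-multiple⇒∣ (Tr-pow-ιV x p) (Tr-pow-divisible x))))
  where open NumberFieldTrace K
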